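{- Let $p$ be a prime, let $w_1$ be a positive integer, let $y_1,y_2\in\mathbb{Z}_p$, and let $n\ge0$ be an integer. Then \begin{align*} \sum_{k=0}^{n}\binom{n}{k}B_{k}(y_{1})B_{n-k}(w_{1}y_{2})w_{1}^{k} &=\sum_{k=0}^{n}\binom{n}{k}B_{k}(y_{2})B_{n-k}(w_{1}y_{1})w_{1}^{k}\\ &=w_{1}^{n-1}\sum_{k=0}^{n}\binom{n}{k}B_{k}(y_{1})\sum_{i=0}^{w_{1}-1}B_{n-k}\Big(y_{2}+\frac{i}{w_{1}}\Big). \end{align*}
   Context: $\mathbb{Z}_p$ denotes the ring of $p$-adic integers. The Bernoulli polynomials $B_n(x)$ are defined by $\frac{t}{e^t-1}e^{xt}=\sum_{n\ge0}B_n(x)\frac{t^n}{n!}$. -}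

module Defs where

open import Level using (Level; _⊔_) renaming (suc to lsuc)
open import Data.Nat as ℕ using (ℕ; zero; suc; _∸_; NonZero)
open import Data.Nat.Combinatorics using (_C_)
open import Data.Integer using (+_)
open import Data.Rational as ℚ using (ℚ)
open import Data.Rational.Properties using (+-*-commutativeRing)
open import Data.Fin using (Fin; toℕ) renaming (zero to fzero; suc to fsuc)
open import Data.Vec as Vec using (Vec; []; _∷ʳ_; lookup)
open import Data.List using (List; foldr; upTo)
open import Algebra.Bundles using (CommutativeRing)
open import Algebra.Morphism.Structures using (IsRingHomomorphism)

sumFinℚ : (m : ℕ) → (Fin m → ℚ) → ℚ
sumFinℚ zero    f = ℚ.0ℚ
sumFinℚ (suc m) f = f fzero ℚ.+ sumFinℚ m (λ i → f (fsuc i))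

-- Bernoulli numbers B_m (convention t/(e^t-1), so B_1 = -1/2), given the
-- previous ones:  B_0 = 1,  B_m = -1/(m+1) * Σ_{k<m} C(m+1,k) B_k.
nextBern : (m : ℕ) → (Fin m → ℚ) → ℚ
nextBern zero    _    = ℚ.1ℚ
nextBern (suc m) prev =
  ℚ.- ((+ 1 ℚ./ suc (suc m)) ℚ.*
        sumFinℚ (suc m) (λ k → (+ (suc (suc m) C toℕ k) ℚ./ 1) ℚ.* prev k))

bernTable : (n : ℕ) → Vec ℚ n
bernTable zero    = []
bernTable (suc n) = bernTable n ∷ʳ nextBern n (lookup (bernTable n))

bernoulli : ℕ → ℚ
bernoulli n = Vec.last (bernTable (suc n))

record QAlgebra (c ℓ : Level) : Set (lsuc (c ⊔ ℓ)) where
  field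
    commRing : CommutativeRing c ℓ
  open CommutativeRing commRing public
  field
    ι     : ℚ → Carrier
    ι-hom : IsRingHomomorphism (CommutativeRing.rawRing +-*-commutativeRing) rawRing ι

module QAlg {c ℓ : Level} (A : QAlgebra c ℓ) where
  open QAlgebra A public

  pow : Carrier → ℕ → Carrier
  pow x zero    = 1#
  pow x (suc n) = x * pow x n

  Σ< : ℕ → (ℕ → Carrier) → Carrier
  Σ< m f = foldr (λ i acc → f i + acc) 0# (upTo m)

  Σ≤ : ℕ → (ℕ → Carrier) → Carrier
  Σ≤ n f = Σ< (suc n) f

  nat : ℕ → Carrier
  nat k = ι (+ k ℚ./ 1)

  B : ℕ → Carrier → Carrier
  B n x = Σ≤ n (λ k → nat (n C k) * ι (bernoulli k) * pow x (n ∸ k))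

{-# OPTIONS --safe #-}
module Submission where

-- Read sequences as exponential generating functions. The Bernoulli polynomials are
-- B(y) = β e^{yt} with β = t/(eᵗ − 1), so the first sum is the coefficient of tⁿ/n! in
-- β(wt) β(t) e^{w(y₁+y₂)t}, which is symmetric in y₁ and y₂. The second identity follows from
-- Raabe's multiplication theorem w B_m(wy) = w^m Σ_{i<w} B_m(y + i/w), which amounts to
-- β(wt) Σ_{i<w} e^{it} = w β(t), i.e. to (e^{wt} − 1)/(eᵗ − 1) = Σ_{i<w} e^{it}. As β is only
-- known through β (eᵗ − 1) = t, identities between series are proved after multiplying by
-- eᵗ − 1, which is cancellable over ℚ.

open import Defs
open import Level using (Level)
open import Function using (_∘_; id)
open import Data.Nat as ℕ using (ℕ; zero; suc; _∸_; _^_; NonZero; _<_; s≤s; z≤n)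
import Data.Nat.Properties as ℕP
open import Data.Nat.Induction using (<-rec)
open import Data.Nat.Combinatorics using (_C_; nCk+nC[k+1]≡[n+1]C[k+1]; k>n⇒nCk≡0; nCk≡nC[n∸k]; nC1≡n)
open import Data.Nat.Primality using (Prime)
open import Data.Integer as ℤ using (+_)
import Data.Integer.Properties as ℤP
open import Data.Rational as ℚ using (ℚ; _/_; 1ℚ)
open import Data.Rational.Properties using (toℚᵘ-injective; toℚᵘ-fromℚᵘ; toℚᵘ-homo-+; toℚᵘ-homo-*)
open import Data.Rational.Unnormalised as ℚᵘ using (mkℚᵘ; *≡*)
import Data.Rational.Unnormalised.Properties as ℚᵘP
open import Data.Fin using (Fin; toℕ; inject₁; fromℕ) renaming (zero to fzero; suc to fsuc)
import Data.Fin.Properties as FinP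
open import Data.Vec using (Vec; []; _∷_; _∷ʳ_; lookup)
import Data.Vec.Properties as VecP
open import Data.List using (foldr; applyUpTo)
open import Data.Sum using (_⊎_; inj₁; inj₂)
open import Data.Product using (∃; _,_; _×_)
open import Relation.Binary.PropositionalEquality as ≡ using (_≡_)
open import Algebra.Bundles using (CommutativeRing)
open import Algebra.Morphism.Structures using (module IsRingHomomorphism)
import Algebra.Properties.CommutativeSemigroup as CommutativeSemigroupProperties
import Algebra.Properties.Ring as RingProperties

toℚᵘ-/ : ∀ m k → ℚ.toℚᵘ (+ m / suc k) ℚᵘ.≃ mkℚᵘ (+ m) k
toℚᵘ-/ m k = toℚᵘ-fromℚᵘ (mkℚᵘ (+ m) k)

[1+k]/1≡1+k/1 : ∀ k → + suc k / 1 ≡ 1ℚ ℚ.+ + k / 1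
[1+k]/1≡1+k/1 k = toℚᵘ-injective (begin
  ℚ.toℚᵘ (+ suc k / 1)                   ≈⟨ toℚᵘ-/ (suc k) 0 ⟩
  mkℚᵘ (+ suc k) 0                       ≈⟨ *≡* (≡.trans (ℤP.*-identityʳ (+ suc k))
                                               (≡.sym (≡.trans (ℤP.*-identityʳ _)
                                                 (≡.cong (ℤ._+_ (+ 1)) (ℤP.*-identityʳ (+ k)))))) ⟩
  mkℚᵘ (+ 1) 0 ℚᵘ.+ mkℚᵘ (+ k) 0         ≈⟨ ℚᵘP.+-cong (toℚᵘ-/ 1 0) (toℚᵘ-/ k 0) ⟨
  ℚ.toℚᵘ 1ℚ ℚᵘ.+ ℚ.toℚᵘ (+ k / 1)        ≈⟨ toℚᵘ-homo-+ 1ℚ (+ k / 1) ⟨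
  ℚ.toℚᵘ (1ℚ ℚ.+ + k / 1)                ∎)
  where open ℚᵘP.≃-Reasoning

1/[1+k]*[1+k]≡1 : ∀ k → (+ 1 / suc k) ℚ.* (+ suc k / 1) ≡ 1ℚ
1/[1+k]*[1+k]≡1 k = toℚᵘ-injective (begin
  ℚ.toℚᵘ ((+ 1 / suc k) ℚ.* (+ suc k / 1))          ≈⟨ toℚᵘ-homo-* (+ 1 / suc k) (+ suc k / 1) ⟩
  ℚ.toℚᵘ (+ 1 / suc k) ℚᵘ.* ℚ.toℚᵘ (+ suc k / 1)    ≈⟨ ℚᵘP.*-cong (toℚᵘ-/ 1 k) (toℚᵘ-/ (suc k) 0) ⟩
  mkℚᵘ (+ 1) k ℚᵘ.* mkℚᵘ (+ suc k) 0                ≈⟨ *≡* (≡.trans (ℤP.*-identityʳ _)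
                                                          (≡.trans (ℤP.*-identityˡ (+ suc k))
                                                            (≡.sym (≡.trans (ℤP.*-identityˡ _)
                                                              (≡.cong +_ (ℕP.*-identityʳ (suc k))))))) ⟩
  ℚ.toℚᵘ 1ℚ                                         ∎)
  where open ℚᵘP.≃-Reasoning

m/[1+k]≡1/[1+k]*m : ∀ m k → + m / suc k ≡ (+ 1 / suc k) ℚ.* (+ m / 1)
m/[1+k]≡1/[1+k]*m m k = toℚᵘ-injective (begin
  ℚ.toℚᵘ (+ m / suc k)                          ≈⟨ toℚᵘ-/ m k ⟩
  mkℚᵘ (+ m) k                                  ≈⟨ *≡* (≡.trans (≡.cong (λ x → + m ℤ.* + x) (ℕP.*-identityʳ (suc k)))
                                                      (≡.cong (ℤ._* + suc k) (≡.sym (ℤP.*-identityˡ (+ m))))) ⟩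
  mkℚᵘ (+ 1) k ℚᵘ.* mkℚᵘ (+ m) 0                ≈⟨ ℚᵘP.*-cong (toℚᵘ-/ 1 k) (toℚᵘ-/ m 0) ⟨
  ℚ.toℚᵘ (+ 1 / suc k) ℚᵘ.* ℚ.toℚᵘ (+ m / 1)    ≈⟨ toℚᵘ-homo-* (+ 1 / suc k) (+ m / 1) ⟨
  ℚ.toℚᵘ ((+ 1 / suc k) ℚ.* (+ m / 1))          ∎)
  where open ℚᵘP.≃-Reasoning

lookup-∷ʳ-inject₁ : ∀ {a} {A : Set a} {n} (xs : Vec A n) x i → lookup (xs ∷ʳ x) (inject₁ i) ≡ lookup xs i
lookup-∷ʳ-inject₁ (y ∷ xs) x fzero    = ≡.refl
lookup-∷ʳ-inject₁ (y ∷ xs) x (fsuc i) = lookup-∷ʳ-inject₁ xs x i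

lookup-∷ʳ-fromℕ : ∀ {a} {A : Set a} {n} (xs : Vec A n) x → lookup (xs ∷ʳ x) (fromℕ n) ≡ x
lookup-∷ʳ-fromℕ []       x = ≡.refl
lookup-∷ʳ-fromℕ (y ∷ xs) x = lookup-∷ʳ-fromℕ xs x

inject₁-or-fromℕ : ∀ {n} (i : Fin (suc n)) → ∃ (λ j → i ≡ inject₁ j) ⊎ i ≡ fromℕ n
inject₁-or-fromℕ {zero}  fzero    = inj₂ ≡.refl
inject₁-or-fromℕ {suc n} fzero    = inj₁ (fzero , ≡.refl)
inject₁-or-fromℕ {suc n} (fsuc i) with inject₁-or-fromℕ i
... | inj₁ (j , ≡.refl) = inj₁ (fsuc j , ≡.refl)
... | inj₂ ≡.refl       = inj₂ ≡.refl

bernoulli-unfold : ∀ m → bernoulli m ≡ nextBern m (lookup (bernTable m))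
bernoulli-unfold m = VecP.last-∷ʳ _ (bernTable m)

lookup-bernTable : ∀ n (i : Fin n) → lookup (bernTable n) i ≡ bernoulli (toℕ i)
lookup-bernTable (suc m) i with inject₁-or-fromℕ i
... | inj₁ (j , ≡.refl) = begin
  lookup (bernTable m ∷ʳ _) (inject₁ j)  ≡⟨ lookup-∷ʳ-inject₁ (bernTable m) _ j ⟩
  lookup (bernTable m) j                 ≡⟨ lookup-bernTable m j ⟩
  bernoulli (toℕ j)                      ≡⟨ ≡.cong bernoulli (FinP.toℕ-inject₁ j) ⟨
  bernoulli (toℕ (inject₁ j))            ∎
  where open ≡.≡-Reasoning
... | inj₂ ≡.refl = begin
  lookup (bernTable m ∷ʳ _) (fromℕ m)    ≡⟨ lookup-∷ʳ-fromℕ (bernTable m) _ ⟩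
  nextBern m (lookup (bernTable m))      ≡⟨ bernoulli-unfold m ⟨
  bernoulli m                            ≡⟨ ≡.cong bernoulli (FinP.toℕ-fromℕ m) ⟨
  bernoulli (toℕ (fromℕ m))              ∎
  where open ≡.≡-Reasoning

[1+n]Cn≡1+n : ∀ n → suc n C n ≡ suc n
[1+n]Cn≡1+n n = begin
  suc n C n              ≡⟨ nCk≡nC[n∸k] (ℕP.n≤1+n n) ⟩
  suc n C (suc n ∸ n)    ≡⟨ ≡.cong (suc n C_) (ℕP.m+n∸n≡m 1 n) ⟩
  suc n C 1              ≡⟨ nC1≡n (suc n) ⟩
  suc n                  ∎
  where open ≡.≡-Reasoning

[1+n]∸k≡1+[n∸k] : ∀ {n k} → k < suc n → suc n ∸ k ≡ suc (n ∸ k)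
[1+n]∸k≡1+[n∸k] k<1+n = ℕP.+-∸-assoc 1 (ℕP.≤-pred k<1+n)

-- Exponential generating functions

module BinomialConvolution {c ℓ : Level} (R : CommutativeRing c ℓ) where
  open CommutativeRing R
  open CommutativeSemigroupProperties +-commutativeSemigroup
    using () renaming (interchange to +-interchange)
  open CommutativeSemigroupProperties *-commutativeSemigroup
    using () renaming (x∙yz≈y∙xz to x*yz≈y*xz)
  open import Relation.Binary.Reasoning.Setoid setoid

  unit-*-cancelˡ : ∀ {i u} x → i * u ≈ 1# → i * (u * x) ≈ x
  unit-*-cancelˡ {i} {u} x iu≈1 = begin
    i * (u * x)  ≈⟨ *-assoc i u x ⟨
    (i * u) * x  ≈⟨ *-cong iu≈1 refl ⟩
    1# * x       ≈⟨ *-identityˡ x ⟩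
    x            ∎

  unit-cancelˡ : ∀ {i u x y} → i * u ≈ 1# → u * x ≈ u * y → x ≈ y
  unit-cancelˡ {i} {u} {x} {y} iu≈1 ux≈uy = begin
    x            ≈⟨ unit-*-cancelˡ x iu≈1 ⟨
    i * (u * x)  ≈⟨ *-cong refl ux≈uy ⟩
    i * (u * y)  ≈⟨ unit-*-cancelˡ y iu≈1 ⟩
    y            ∎

  ∑ : ℕ → (ℕ → Carrier) → Carrier
  ∑ zero    f = 0#
  ∑ (suc m) f = f 0 + ∑ m (f ∘ suc)

  ∑-cong< : ∀ m {f g} → (∀ k → k < m → f k ≈ g k) → ∑ m f ≈ ∑ m g
  ∑-cong< zero    f≈g = refl
  ∑-cong< (suc m) f≈g = +-cong (f≈g 0 (s≤s z≤n)) (∑-cong< m (λ k k<m → f≈g (suc k) (s≤s k<m)))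

  ∑-cong : ∀ m {f g} → (∀ k → f k ≈ g k) → ∑ m f ≈ ∑ m g
  ∑-cong m f≈g = ∑-cong< m (λ k _ → f≈g k)

  ∑-last : ∀ m f → ∑ (suc m) f ≈ ∑ m f + f m
  ∑-last zero    f = +-comm (f 0) 0#
  ∑-last (suc m) f = trans (+-cong refl (∑-last m (f ∘ suc))) (sym (+-assoc _ _ _))

  ∑-distrib-+ : ∀ m f g → ∑ m (λ k → f k + g k) ≈ ∑ m f + ∑ m g
  ∑-distrib-+ zero    f g = sym (+-identityˡ 0#)
  ∑-distrib-+ (suc m) f g = trans (+-cong refl (∑-distrib-+ m (f ∘ suc) (g ∘ suc))) (+-interchange _ _ _ _)

  ∑-*ˡ : ∀ m x f → ∑ m (λ k → x * f k) ≈ x * ∑ m f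
  ∑-*ˡ zero    x f = sym (zeroʳ x)
  ∑-*ˡ (suc m) x f = trans (+-cong refl (∑-*ˡ m x (f ∘ suc))) (sym (distribˡ x _ _))

  -- A sequence a stands for the series Σ aₙ tⁿ/n!: ∂ is d/dt, and the product
  -- (a ⋆ b) n = Σ_k C(n,k) a_k b_{n-k} is defined through the Leibniz rule.
  Seq : Set c
  Seq = ℕ → Carrier

  infix  4 _≋_
  infixl 6 _+ₛ_
  infixr 7 _·_
  infixl 7 _⋆_

  _≋_ : Seq → Seq → Set ℓ
  a ≋ b = ∀ n → a n ≈ b n

  _+ₛ_ : Seq → Seq → Seq
  (a +ₛ b) n = a n + b n

  _·_ : Carrier → Seq → Seq
  (x · a) n = x * a n

  0ₛ : Seq
  0ₛ _ = 0#

  ∂ : Seq → Seq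
  ∂ a = a ∘ suc

  _⋆_ : Seq → Seq → Seq
  (a ⋆ b) zero    = a 0 * b 0
  (a ⋆ b) (suc n) = (∂ a ⋆ b) n + (a ⋆ ∂ b) n

  ⋆-cong : ∀ {a a′ b b′} → a ≋ a′ → b ≋ b′ → a ⋆ b ≋ a′ ⋆ b′
  ⋆-cong a≋a′ b≋b′ zero    = *-cong (a≋a′ 0) (b≋b′ 0)
  ⋆-cong a≋a′ b≋b′ (suc n) = +-cong (⋆-cong (a≋a′ ∘ suc) b≋b′ n) (⋆-cong a≋a′ (b≋b′ ∘ suc) n)

  ⋆-congˡ : ∀ {a a′} b → a ≋ a′ → a ⋆ b ≋ a′ ⋆ b
  ⋆-congˡ b a≋a′ = ⋆-cong a≋a′ (λ _ → refl)

  ⋆-congʳ : ∀ a {b b′} → b ≋ b′ → a ⋆ b ≋ a ⋆ b′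
  ⋆-congʳ a b≋b′ = ⋆-cong (λ _ → refl) b≋b′

  ⋆-comm : ∀ a b → a ⋆ b ≋ b ⋆ a
  ⋆-comm a b zero    = *-comm (a 0) (b 0)
  ⋆-comm a b (suc n) = trans (+-cong (⋆-comm (∂ a) b n) (⋆-comm a (∂ b) n)) (+-comm _ _)

  ⋆-distribʳ : ∀ a a′ b → (a +ₛ a′) ⋆ b ≋ a ⋆ b +ₛ a′ ⋆ b
  ⋆-distribʳ a a′ b zero    = distribʳ (b 0) (a 0) (a′ 0)
  ⋆-distribʳ a a′ b (suc n) =
    trans (+-cong (⋆-distribʳ (∂ a) (∂ a′) b n) (⋆-distribʳ a a′ (∂ b) n)) (+-interchange _ _ _ _)

  ⋆-distribˡ : ∀ a b b′ → a ⋆ (b +ₛ b′) ≋ a ⋆ b +ₛ a ⋆ b′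
  ⋆-distribˡ a b b′ zero    = distribˡ (a 0) (b 0) (b′ 0)
  ⋆-distribˡ a b b′ (suc n) =
    trans (+-cong (⋆-distribˡ (∂ a) b b′ n) (⋆-distribˡ a (∂ b) (∂ b′) n)) (+-interchange _ _ _ _)

  ⋆-·ˡ : ∀ x a b → (x · a) ⋆ b ≋ x · (a ⋆ b)
  ⋆-·ˡ x a b zero    = *-assoc x (a 0) (b 0)
  ⋆-·ˡ x a b (suc n) = trans (+-cong (⋆-·ˡ x (∂ a) b n) (⋆-·ˡ x a (∂ b) n)) (sym (distribˡ x _ _))

  ⋆-·ʳ : ∀ x a b → a ⋆ (x · b) ≋ x · (a ⋆ b)
  ⋆-·ʳ x a b zero    = x*yz≈y*xz (a 0) x (b 0)
  ⋆-·ʳ x a b (suc n) = trans (+-cong (⋆-·ʳ x (∂ a) b n) (⋆-·ʳ x a (∂ b) n)) (sym (distribˡ x _ _))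

  ⋆-zeroʳ : ∀ a → a ⋆ 0ₛ ≋ 0ₛ
  ⋆-zeroʳ a zero    = zeroʳ (a 0)
  ⋆-zeroʳ a (suc n) = trans (+-cong (⋆-zeroʳ (∂ a) n) (⋆-zeroʳ a n)) (+-identityˡ 0#)

  ⋆-assoc : ∀ a b c → (a ⋆ b) ⋆ c ≋ a ⋆ (b ⋆ c)
  ⋆-assoc a b c zero    = *-assoc (a 0) (b 0) (c 0)
  ⋆-assoc a b c (suc n) = begin
    ((∂ a ⋆ b +ₛ a ⋆ ∂ b) ⋆ c) n + ((a ⋆ b) ⋆ ∂ c) n
      ≈⟨ +-cong (⋆-distribʳ (∂ a ⋆ b) (a ⋆ ∂ b) c n) (⋆-assoc a b (∂ c) n) ⟩
    (((∂ a ⋆ b) ⋆ c) n + ((a ⋆ ∂ b) ⋆ c) n) + (a ⋆ (b ⋆ ∂ c)) n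
      ≈⟨ +-cong (+-cong (⋆-assoc (∂ a) b c n) (⋆-assoc a (∂ b) c n)) refl ⟩
    ((∂ a ⋆ (b ⋆ c)) n + (a ⋆ (∂ b ⋆ c)) n) + (a ⋆ (b ⋆ ∂ c)) n
      ≈⟨ +-assoc _ _ _ ⟩
    (∂ a ⋆ (b ⋆ c)) n + ((a ⋆ (∂ b ⋆ c)) n + (a ⋆ (b ⋆ ∂ c)) n)
      ≈⟨ +-cong refl (⋆-distribˡ a (∂ b ⋆ c) (b ⋆ ∂ c) n) ⟨
    (∂ a ⋆ (b ⋆ c)) n + (a ⋆ (∂ b ⋆ c +ₛ b ⋆ ∂ c)) n
      ∎

  ⋆-∑ʳ : ∀ m a (f : ℕ → Seq) → a ⋆ (λ k → ∑ m (λ i → f i k)) ≋ (λ k → ∑ m (λ i → (a ⋆ f i) k))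
  ⋆-∑ʳ zero    a f = ⋆-zeroʳ a
  ⋆-∑ʳ (suc m) a f n =
    trans (⋆-distribˡ a (f 0) (λ k → ∑ m (λ i → f (suc i) k)) n) (+-cong refl (⋆-∑ʳ m a (f ∘ suc) n))

  ⋆-interchange : ∀ a b c d → (a ⋆ b) ⋆ (c ⋆ d) ≋ (a ⋆ c) ⋆ (b ⋆ d)
  ⋆-interchange a b c d n = begin
    ((a ⋆ b) ⋆ (c ⋆ d)) n  ≈⟨ ⋆-assoc a b (c ⋆ d) n ⟩
    (a ⋆ (b ⋆ (c ⋆ d))) n  ≈⟨ ⋆-congʳ a b⋆[c⋆d]≋c⋆[b⋆d] n ⟩
    (a ⋆ (c ⋆ (b ⋆ d))) n  ≈⟨ ⋆-assoc a c (b ⋆ d) n ⟨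
    ((a ⋆ c) ⋆ (b ⋆ d)) n  ∎
    where
    b⋆[c⋆d]≋c⋆[b⋆d] : b ⋆ (c ⋆ d) ≋ c ⋆ (b ⋆ d)
    b⋆[c⋆d]≋c⋆[b⋆d] k = trans (sym (⋆-assoc b c d k)) (trans (⋆-congˡ d (⋆-comm b c) k) (⋆-assoc c b d k))

-- Bernoulli numbers and polynomials in a ℚ-algebra

module _ {c ℓ : Level} (A : QAlgebra c ℓ) where
  open QAlg A
  open IsRingHomomorphism ι-hom using (+-homo; *-homo; 0#-homo; 1#-homo; -‿homo; ⟦⟧-cong)
  open BinomialConvolution commRing
  open RingProperties ring using (-‿distribʳ-*; +-cancelˡ; +-cancelʳ)
  open CommutativeSemigroupProperties +-commutativeSemigroup
    using () renaming (x∙yz≈y∙xz to x+yz≈y+xz; xy∙z≈xz∙y to xy+z≈xz+y)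
  open CommutativeSemigroupProperties *-commutativeSemigroup
    using () renaming (interchange to *-interchange; xy∙z≈xz∙y to xy*z≈xz*y; xy∙z≈x∙zy to xy*z≈x*zy)
  open import Relation.Binary.Reasoning.Setoid setoid

  nat-suc : ∀ k → nat (suc k) ≈ 1# + nat k
  nat-suc k = trans (⟦⟧-cong ([1+k]/1≡1+k/1 k)) (trans (+-homo 1ℚ (+ k / 1)) (+-cong 1#-homo refl))

  nat-+ : ∀ m n → nat (m ℕ.+ n) ≈ nat m + nat n
  nat-+ zero    n = trans (sym (+-identityˡ _)) (+-cong (sym 0#-homo) refl)
  nat-+ (suc m) n = begin
    nat (suc (m ℕ.+ n))        ≈⟨ nat-suc (m ℕ.+ n) ⟩
    1# + nat (m ℕ.+ n)         ≈⟨ +-cong refl (nat-+ m n) ⟩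
    1# + (nat m + nat n)       ≈⟨ +-assoc _ _ _ ⟨
    (1# + nat m) + nat n       ≈⟨ +-cong (nat-suc m) refl ⟨
    nat (suc m) + nat n        ∎

  nat-* : ∀ m n → nat (m ℕ.* n) ≈ nat m * nat n
  nat-* zero    n = trans 0#-homo (trans (sym (zeroˡ (nat n))) (*-cong (sym 0#-homo) refl))
  nat-* (suc m) n = begin
    nat (n ℕ.+ m ℕ.* n)        ≈⟨ nat-+ n (m ℕ.* n) ⟩
    nat n + nat (m ℕ.* n)      ≈⟨ +-cong (sym (*-identityˡ _)) (nat-* m n) ⟩
    1# * nat n + nat m * nat n ≈⟨ distribʳ _ _ _ ⟨
    (1# + nat m) * nat n       ≈⟨ *-cong (nat-suc m) refl ⟨
    nat (suc m) * nat n        ∎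

  nat-^ : ∀ m n → nat (m ^ n) ≈ pow (nat m) n
  nat-^ m zero    = 1#-homo
  nat-^ m (suc n) = trans (nat-* m (m ^ n)) (*-cong refl (nat-^ m n))

  ι[1/[1+k]]*[1+k]≈1 : ∀ k → ι (+ 1 / suc k) * nat (suc k) ≈ 1#
  ι[1/[1+k]]*[1+k]≈1 k = trans (sym (*-homo _ _)) (trans (⟦⟧-cong (1/[1+k]*[1+k]≡1 k)) 1#-homo)

  ι[m/[1+k]]≈ι[1/[1+k]]*m : ∀ m k → ι (+ m / suc k) ≈ ι (+ 1 / suc k) * nat m
  ι[m/[1+k]]≈ι[1/[1+k]]*m m k = trans (⟦⟧-cong (m/[1+k]≡1/[1+k]*m m k)) (*-homo _ _)

  ι-sumFinℚ : ∀ m (g : Fin m → ℚ) (f : ℕ → ℚ) → (∀ i → g i ≡ f (toℕ i)) →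
              ι (sumFinℚ m g) ≈ ∑ m (ι ∘ f)
  ι-sumFinℚ zero    g f g≡f = 0#-homo
  ι-sumFinℚ (suc m) g f g≡f = trans (+-homo _ _)
    (+-cong (reflexive (≡.cong ι (g≡f fzero))) (ι-sumFinℚ m (g ∘ fsuc) (f ∘ suc) (g≡f ∘ fsuc)))

  Σ<≈∑ : ∀ m f → Σ< m f ≈ ∑ m f
  Σ<≈∑ m f = reflexive (foldr-applyUpTo m id)
    where
    foldr-applyUpTo : ∀ m g → foldr (λ i acc → f i + acc) 0# (applyUpTo g m) ≡ ∑ m (f ∘ g)
    foldr-applyUpTo zero    g = ≡.refl
    foldr-applyUpTo (suc m) g = ≡.cong (λ r → f (g 0) + r) (foldr-applyUpTo m (g ∘ suc))

  binomial-sum≈⋆ : ∀ n a b → ∑ (suc n) (λ k → nat (n C k) * a k * b (n ∸ k)) ≈ (a ⋆ b) n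
  binomial-sum≈⋆ zero    a b = trans (+-identityʳ _) (*-cong (trans (*-cong 1#-homo refl) (*-identityˡ _)) refl)
  binomial-sum≈⋆ (suc n) a b = begin
    nat 1 * a 0 * b (suc n) + ∑ (suc n) (λ k → nat (suc n C suc k) * a (suc k) * b (n ∸ k))
      ≈⟨ +-cong refl (trans (∑-cong (suc n) pascal) (∑-distrib-+ (suc n) left right)) ⟩
    nat 1 * a 0 * b (suc n) + (∑ (suc n) left + ∑ (suc n) right)
      ≈⟨ x+yz≈y+xz _ _ _ ⟩
    ∑ (suc n) left + (nat 1 * a 0 * b (suc n) + ∑ (suc n) right)
      ≈⟨ +-cong (binomial-sum≈⋆ n (∂ a) b) (trans shift (binomial-sum≈⋆ n a (∂ b))) ⟩
    (∂ a ⋆ b) n + (a ⋆ ∂ b) n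
      ∎
    where
    left right : ℕ → Carrier
    left  k = nat (n C k) * a (suc k) * b (n ∸ k)
    right k = nat (n C suc k) * a (suc k) * b (n ∸ k)

    pascal : ∀ k → nat (suc n C suc k) * a (suc k) * b (n ∸ k) ≈ left k + right k
    pascal k = begin
      nat (suc n C suc k) * a (suc k) * b (n ∸ k)
        ≈⟨ *-cong (*-cong (reflexive (≡.cong nat (≡.sym (nCk+nC[k+1]≡[n+1]C[k+1] n k)))) refl) refl ⟩
      nat (n C k ℕ.+ n C suc k) * a (suc k) * b (n ∸ k)
        ≈⟨ *-cong (*-cong (nat-+ (n C k) (n C suc k)) refl) refl ⟩
      (nat (n C k) + nat (n C suc k)) * a (suc k) * b (n ∸ k)
        ≈⟨ trans (*-cong (distribʳ _ _ _) refl) (distribʳ _ _ _) ⟩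
      left k + right k
        ∎

    shifted : ℕ → Carrier
    shifted k = nat (n C k) * a k * b (suc n ∸ k)

    shift : nat 1 * a 0 * b (suc n) + ∑ (suc n) right ≈ ∑ (suc n) (λ k → nat (n C k) * a k * ∂ b (n ∸ k))
    shift = begin
      ∑ (suc (suc n)) shifted
        ≈⟨ ∑-last (suc n) shifted ⟩
      ∑ (suc n) shifted + nat (n C suc n) * a (suc n) * b (n ∸ n)
        ≈⟨ +-cong refl (*-cong (*-cong (reflexive (≡.cong nat (k>n⇒nCk≡0 (ℕP.n<1+n n)))) refl) refl) ⟩
      ∑ (suc n) shifted + nat 0 * a (suc n) * b (n ∸ n)
        ≈⟨ +-cong refl (trans (*-cong (*-cong 0#-homo refl) refl) (trans (*-cong (zeroˡ _) refl) (zeroˡ _))) ⟩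
      ∑ (suc n) shifted + 0#
        ≈⟨ +-identityʳ _ ⟩
      ∑ (suc n) shifted
        ≈⟨ ∑-cong< (suc n) {f = shifted} (λ k k<1+n → *-cong refl (reflexive (≡.cong b ([1+n]∸k≡1+[n∸k] k<1+n)))) ⟩
      ∑ (suc n) (λ k → nat (n C k) * a k * ∂ b (n ∸ k))
        ∎

  pow-cong : ∀ n {x y} → x ≈ y → pow x n ≈ pow y n
  pow-cong zero    x≈y = refl
  pow-cong (suc n) x≈y = *-cong x≈y (pow-cong n x≈y)

  pow-distrib-* : ∀ x y n → pow (x * y) n ≈ pow x n * pow y n
  pow-distrib-* x y zero    = sym (*-identityˡ 1#)
  pow-distrib-* x y (suc n) = trans (*-cong refl (pow-distrib-* x y n)) (*-interchange _ _ _ _)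

  pow-1# : ∀ n → pow 1# n ≈ 1#
  pow-1# zero    = refl
  pow-1# (suc n) = trans (*-identityˡ _) (pow-1# n)

  pow⋆pow : ∀ x y → pow x ⋆ pow y ≋ pow (x + y)
  pow⋆pow x y zero    = *-identityˡ 1#
  pow⋆pow x y (suc n) = begin
    ((x · pow x) ⋆ pow y) n + (pow x ⋆ (y · pow y)) n
      ≈⟨ +-cong (⋆-·ˡ x (pow x) (pow y) n) (⋆-·ʳ y (pow x) (pow y) n) ⟩
    x * (pow x ⋆ pow y) n + y * (pow x ⋆ pow y) n     ≈⟨ distribʳ _ x y ⟨
    (x + y) * (pow x ⋆ pow y) n                       ≈⟨ *-cong refl (pow⋆pow x y n) ⟩
    (x + y) * pow (x + y) n                           ∎

  -- dilate w a is the series a(wt).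
  dilate : Carrier → Seq → Seq
  dilate w a n = pow w n * a n

  ∂-dilate : ∀ w a → ∂ (dilate w a) ≋ w · dilate w (∂ a)
  ∂-dilate w a n = *-assoc w (pow w n) (a (suc n))

  dilate-⋆ : ∀ w a b → dilate w a ⋆ dilate w b ≋ dilate w (a ⋆ b)
  dilate-⋆ w a b zero    = trans (*-cong (*-identityˡ _) (*-identityˡ _)) (sym (*-identityˡ _))
  dilate-⋆ w a b (suc n) = begin
    (∂ (dilate w a) ⋆ dilate w b) n + (dilate w a ⋆ ∂ (dilate w b)) n
      ≈⟨ +-cong (⋆-congˡ (dilate w b) (∂-dilate w a) n) (⋆-congʳ (dilate w a) (∂-dilate w b) n) ⟩
    ((w · dilate w (∂ a)) ⋆ dilate w b) n + (dilate w a ⋆ (w · dilate w (∂ b))) n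
      ≈⟨ +-cong (⋆-·ˡ w _ _ n) (⋆-·ʳ w _ _ n) ⟩
    w * (dilate w (∂ a) ⋆ dilate w b) n + w * (dilate w a ⋆ dilate w (∂ b)) n
      ≈⟨ +-cong (*-cong refl (dilate-⋆ w (∂ a) b n)) (*-cong refl (dilate-⋆ w a (∂ b) n)) ⟩
    w * (pow w n * (∂ a ⋆ b) n) + w * (pow w n * (a ⋆ ∂ b) n)
      ≈⟨ trans (sym (distribˡ w _ _)) (*-cong refl (sym (distribˡ (pow w n) _ _))) ⟩
    w * (pow w n * (a ⋆ b) (suc n))
      ≈⟨ *-assoc w (pow w n) _ ⟨
    dilate w (a ⋆ b) (suc n)
      ∎

  dilate-pow : ∀ w y → dilate w (pow y) ≋ pow (w * y)
  dilate-pow w y n = sym (pow-distrib-* w y n)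

  β : Seq
  β k = ι (bernoulli k)

  -- The series eᵗ − 1, t and 1.
  expMinusOne var one : Seq
  expMinusOne zero    = 0#
  expMinusOne (suc _) = 1#
  var zero          = 0#
  var (suc zero)    = 1#
  var (suc (suc _)) = 0#
  one zero    = 1#
  one (suc _) = 0#

  pow-0# : pow 0# ≋ one
  pow-0# zero    = refl
  pow-0# (suc n) = zeroˡ _

  ⋆-one : ∀ a → a ⋆ one ≋ a
  ⋆-one a zero    = *-identityʳ (a 0)
  ⋆-one a (suc n) = trans (+-cong (⋆-one (∂ a) n) (⋆-zeroʳ a n)) (+-identityʳ _)

  dilate-expMinusOne+one : ∀ w → dilate w expMinusOne +ₛ one ≋ pow w
  dilate-expMinusOne+one w zero    = trans (+-cong (zeroʳ 1#) refl) (+-identityˡ 1#)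
  dilate-expMinusOne+one w (suc n) = trans (+-identityʳ _) (*-identityʳ _)

  dilate-var : ∀ w → dilate w var ≋ w · var
  dilate-var w zero          = trans (zeroʳ _) (sym (zeroʳ w))
  dilate-var w (suc zero)    = *-identityʳ _
  dilate-var w (suc (suc n)) = trans (zeroʳ _) (sym (zeroʳ w))

  ⋆-expMinusOne : ∀ m a → (a ⋆ expMinusOne) (suc m) ≈ ∑ (suc m) (λ k → nat (suc m C k) * a k)
  ⋆-expMinusOne m a = begin
    (a ⋆ expMinusOne) (suc m)
      ≈⟨ binomial-sum≈⋆ (suc m) a expMinusOne ⟨
    ∑ (suc (suc m)) summand
      ≈⟨ ∑-last (suc m) summand ⟩
    ∑ (suc m) summand + nat (suc m C suc m) * a (suc m) * expMinusOne (m ∸ m)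
      ≈⟨ +-cong refl (trans (*-cong refl (reflexive (≡.cong expMinusOne (ℕP.n∸n≡0 m)))) (zeroʳ _)) ⟩
    ∑ (suc m) summand + 0#
      ≈⟨ +-identityʳ _ ⟩
    ∑ (suc m) summand
      ≈⟨ ∑-cong< (suc m) {f = summand} (λ k k<1+m →
           trans (*-cong refl (reflexive (≡.cong expMinusOne ([1+n]∸k≡1+[n∸k] k<1+m)))) (*-identityʳ _)) ⟩
    ∑ (suc m) (λ k → nat (suc m C k) * a k)
      ∎
    where
    summand : ℕ → Carrier
    summand k = nat (suc m C k) * a k * expMinusOne (suc m ∸ k)

  β⋆expMinusOne≋var : β ⋆ expMinusOne ≋ var
  β⋆expMinusOne≋var zero          = zeroʳ (β 0)
  β⋆expMinusOne≋var (suc zero)    =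
    trans (⋆-expMinusOne 0 β) (trans (+-identityʳ _) (trans (*-cong 1#-homo 1#-homo) (*-identityˡ 1#)))
  β⋆expMinusOne≋var (suc (suc j)) = begin
    (β ⋆ expMinusOne) (suc N)
      ≈⟨ ⋆-expMinusOne N β ⟩
    ∑ (suc N) (λ k → nat (suc N C k) * β k)
      ≈⟨ ∑-last N (λ k → nat (suc N C k) * β k) ⟩
    X + nat (suc N C N) * β N
      ≈⟨ +-cong refl (*-cong (reflexive (≡.cong nat ([1+n]Cn≡1+n N))) β-unfold) ⟩
    X + nat (suc N) * - (ι (+ 1 / suc N) * X)
      ≈⟨ +-cong refl (-‿distribʳ-* _ _) ⟨
    X + - (nat (suc N) * (ι (+ 1 / suc N) * X))
      ≈⟨ +-cong refl (-‿cong (unit-*-cancelˡ X (trans (*-comm _ _) (ι[1/[1+k]]*[1+k]≈1 N)))) ⟩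
    X + - X
      ≈⟨ -‿inverseʳ X ⟩
    0#
      ∎
    where
    N : ℕ
    N = suc j
    X : Carrier
    X = ∑ N (λ k → nat (suc N C k) * β k)
    β-unfold : β N ≈ - (ι (+ 1 / suc N) * X)
    β-unfold = begin
      ι (bernoulli N)
        ≈⟨ reflexive (≡.cong ι (bernoulli-unfold N)) ⟩
      ι (ℚ.- ((+ 1 / suc N) ℚ.* sumFinℚ N (λ k → (+ (suc N C toℕ k) / 1) ℚ.* lookup (bernTable N) k)))
        ≈⟨ trans (-‿homo _) (-‿cong (*-homo _ _)) ⟩
      - (ι (+ 1 / suc N) * ι (sumFinℚ N (λ k → (+ (suc N C toℕ k) / 1) ℚ.* lookup (bernTable N) k)))
        ≈⟨ -‿cong (*-cong refl (ι-sumFinℚ N _ (λ k → (+ (suc N C k) / 1) ℚ.* bernoulli k)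
             (λ i → ≡.cong ((+ (suc N C toℕ i) / 1) ℚ.*_) (lookup-bernTable N i)))) ⟩
      - (ι (+ 1 / suc N) * ∑ N (λ k → ι ((+ (suc N C k) / 1) ℚ.* bernoulli k)))
        ≈⟨ -‿cong (*-cong refl (∑-cong N {g = λ k → nat (suc N C k) * β k} (λ k → *-homo _ _))) ⟩
      - (ι (+ 1 / suc N) * X)
        ∎

  expMinusOne-cancel : ∀ {a b} → a ⋆ expMinusOne ≋ b ⋆ expMinusOne → a ≋ b
  expMinusOne-cancel {a} {b} a⋆e≋b⋆e = <-rec (λ k → a k ≈ b k) step
    where
    ∑-binomial : Seq → ℕ → Carrier
    ∑-binomial s n = ∑ n (λ k → nat (suc n C k) * s k)

    -- In (a ⋆ (eᵗ − 1)) (n + 1) = Σ_{k ≤ n} C(n+1,k) aₖ the top coefficient n + 1 is invertible.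
    step : ∀ n → (∀ {k} → k < n → a k ≈ b k) → a n ≈ b n
    step n ih = unit-cancelˡ (ι[1/[1+k]]*[1+k]≈1 n) (begin
      nat (suc n) * a n        ≈⟨ *-cong (reflexive (≡.cong nat ([1+n]Cn≡1+n n))) refl ⟨
      nat (suc n C n) * a n    ≈⟨ +-cancelˡ (∑-binomial a n) _ _ top ⟩
      nat (suc n C n) * b n    ≈⟨ *-cong (reflexive (≡.cong nat ([1+n]Cn≡1+n n))) refl ⟩
      nat (suc n) * b n        ∎)
      where
      top : ∑-binomial a n + nat (suc n C n) * a n ≈ ∑-binomial a n + nat (suc n C n) * b n
      top = begin
        ∑-binomial a n + nat (suc n C n) * a n  ≈⟨ ∑-last n _ ⟨
        ∑ (suc n) (λ k → nat (suc n C k) * a k) ≈⟨ ⋆-expMinusOne n a ⟨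
        (a ⋆ expMinusOne) (suc n)               ≈⟨ a⋆e≋b⋆e (suc n) ⟩
        (b ⋆ expMinusOne) (suc n)               ≈⟨ ⋆-expMinusOne n b ⟩
        ∑ (suc n) (λ k → nat (suc n C k) * b k) ≈⟨ ∑-last n _ ⟩
        ∑-binomial b n + nat (suc n C n) * b n  ≈⟨ +-cong (∑-cong< n (λ k k<n → *-cong refl (sym (ih k<n)))) refl ⟩
        ∑-binomial a n + nat (suc n C n) * b n  ∎

  geometric : ℕ → Seq
  geometric w n = ∑ w (λ i → pow (nat i) n)

  pow⋆expMinusOne : ∀ x → pow x ⋆ expMinusOne +ₛ pow x ≋ pow (x + 1#)
  pow⋆expMinusOne x n = begin
    (pow x ⋆ expMinusOne) n + pow x n          ≈⟨ +-cong refl (⋆-one (pow x) n) ⟨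
    (pow x ⋆ expMinusOne) n + (pow x ⋆ one) n  ≈⟨ ⋆-distribˡ (pow x) expMinusOne one n ⟨
    (pow x ⋆ (expMinusOne +ₛ one)) n           ≈⟨ ⋆-congʳ (pow x) expMinusOne+one≋pow1 n ⟩
    (pow x ⋆ pow 1#) n                         ≈⟨ pow⋆pow x 1# n ⟩
    pow (x + 1#) n                             ∎
    where
    expMinusOne+one≋pow1 : expMinusOne +ₛ one ≋ pow 1#
    expMinusOne+one≋pow1 zero    = +-identityˡ 1#
    expMinusOne+one≋pow1 (suc k) = trans (+-identityʳ 1#) (sym (pow-1# (suc k)))

  geometric⋆expMinusOne : ∀ w → geometric w ⋆ expMinusOne ≋ dilate (nat w) expMinusOne
  geometric⋆expMinusOne w n = +-cancelʳ (one n) _ _ (begin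
    (geometric w ⋆ expMinusOne) n + one n
      ≈⟨ +-cong (trans (⋆-comm _ _ n) (⋆-∑ʳ w expMinusOne (λ i → pow (nat i)) n)) refl ⟩
    ∑ w (λ i → (expMinusOne ⋆ pow (nat i)) n) + one n
      ≈⟨ telescope w ⟩
    pow (nat w) n
      ≈⟨ dilate-expMinusOne+one (nat w) n ⟨
    dilate (nat w) expMinusOne n + one n
      ∎)
    where
    telescope : ∀ m → ∑ m (λ i → (expMinusOne ⋆ pow (nat i)) n) + one n ≈ pow (nat m) n
    telescope zero    = trans (+-identityˡ _) (sym (trans (pow-cong n 0#-homo) (pow-0# n)))
    telescope (suc m) = begin
      ∑ (suc m) F + one n                                ≈⟨ +-cong (∑-last m F) refl ⟩
      (∑ m F + F m) + one n                              ≈⟨ xy+z≈xz+y _ _ _ ⟩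
      (∑ m F + one n) + F m                              ≈⟨ +-cong (telescope m) (⋆-comm _ _ n) ⟩
      pow (nat m) n + (pow (nat m) ⋆ expMinusOne) n      ≈⟨ +-comm _ _ ⟩
      (pow (nat m) ⋆ expMinusOne) n + pow (nat m) n      ≈⟨ pow⋆expMinusOne (nat m) n ⟩
      pow (nat m + 1#) n                                 ≈⟨ pow-cong n (trans (+-comm _ _) (sym (nat-suc m))) ⟩
      pow (nat (suc m)) n                                ∎
      where
      F : ℕ → Carrier
      F i = (expMinusOne ⋆ pow (nat i)) n

  -- Both sides times eᵗ − 1 equal w t, as Σ_{i<w} e^{it} (eᵗ − 1) = e^{wt} − 1.
  dilateβ⋆geometric : ∀ w → dilate (nat w) β ⋆ geometric w ≋ nat w · β
  dilateβ⋆geometric w = expMinusOne-cancel (λ n → begin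
    ((dilate W β ⋆ geometric w) ⋆ expMinusOne) n  ≈⟨ ⋆-assoc _ _ _ n ⟩
    (dilate W β ⋆ (geometric w ⋆ expMinusOne)) n  ≈⟨ ⋆-congʳ _ (geometric⋆expMinusOne w) n ⟩
    (dilate W β ⋆ dilate W expMinusOne) n         ≈⟨ dilate-⋆ W β expMinusOne n ⟩
    pow W n * (β ⋆ expMinusOne) n                 ≈⟨ *-cong refl (β⋆expMinusOne≋var n) ⟩
    dilate W var n                                ≈⟨ dilate-var W n ⟩
    W * var n                                     ≈⟨ *-cong refl (β⋆expMinusOne≋var n) ⟨
    W * (β ⋆ expMinusOne) n                       ≈⟨ ⋆-·ˡ W β expMinusOne n ⟨
    ((W · β) ⋆ expMinusOne) n                     ∎)
    where
    W : Carrier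
    W = nat w

  Bseq : Carrier → Seq
  Bseq y m = B m y

  B≋β⋆pow : ∀ y → Bseq y ≋ β ⋆ pow y
  B≋β⋆pow y m = trans (Σ<≈∑ (suc m) _) (binomial-sum≈⋆ m β (pow y))

  dilate-β⋆pow : ∀ w y → dilate w (β ⋆ pow y) ≋ dilate w β ⋆ pow (w * y)
  dilate-β⋆pow w y n = trans (sym (dilate-⋆ w β (pow y) n)) (⋆-congʳ (dilate w β) (dilate-pow w y) n)

  ∑-B-shift : ∀ w y (x : ℕ → Carrier) →
              (λ m → ∑ w (λ i → B m (y + x i))) ≋ (β ⋆ pow y) ⋆ (λ k → ∑ w (λ i → pow (x i) k))
  ∑-B-shift w y x m = begin
    ∑ w (λ i → B m (y + x i))                 ≈⟨ ∑-cong w shift ⟩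
    ∑ w (λ i → ((β ⋆ pow y) ⋆ pow (x i)) m)   ≈⟨ ⋆-∑ʳ w (β ⋆ pow y) (λ i → pow (x i)) m ⟨
    ((β ⋆ pow y) ⋆ (λ k → ∑ w (λ i → pow (x i) k))) m ∎
    where
    shift : ∀ i → B m (y + x i) ≈ ((β ⋆ pow y) ⋆ pow (x i)) m
    shift i = begin
      B m (y + x i)                 ≈⟨ B≋β⋆pow (y + x i) m ⟩
      (β ⋆ pow (y + x i)) m         ≈⟨ ⋆-congʳ β (pow⋆pow y (x i)) m ⟨
      (β ⋆ (pow y ⋆ pow (x i))) m   ≈⟨ ⋆-assoc β (pow y) (pow (x i)) m ⟨
      ((β ⋆ pow y) ⋆ pow (x i)) m   ∎

  multiplication-theorem : ∀ w .{{_ : NonZero w}} y m →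
    nat w * B m (nat w * y) ≈ pow (nat w) m * Σ< w (λ i → B m (y + ι (+ i / w)))
  multiplication-theorem w@(suc v) y m = sym (begin
    pow W m * Σ< w (λ i → B m (y + offset i))
      ≈⟨ *-cong refl (trans (Σ<≈∑ w _) (∑-B-shift w y offset m)) ⟩
    dilate W ((β ⋆ pow y) ⋆ G) m
      ≈⟨ dilate-⋆ W (β ⋆ pow y) G m ⟨
    (dilate W (β ⋆ pow y) ⋆ dilate W G) m
      ≈⟨ ⋆-cong (dilate-β⋆pow W y) dilate-G m ⟩
    ((dilate W β ⋆ pow (W * y)) ⋆ geometric w) m
      ≈⟨ ⋆-congˡ (geometric w) (⋆-comm _ _) m ⟩
    ((pow (W * y) ⋆ dilate W β) ⋆ geometric w) m
      ≈⟨ ⋆-assoc _ _ _ m ⟩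
    (pow (W * y) ⋆ (dilate W β ⋆ geometric w)) m
      ≈⟨ ⋆-congʳ _ (dilateβ⋆geometric w) m ⟩
    (pow (W * y) ⋆ (W · β)) m
      ≈⟨ ⋆-·ʳ W _ β m ⟩
    W * (pow (W * y) ⋆ β) m
      ≈⟨ *-cong refl (trans (⋆-comm _ _ m) (sym (B≋β⋆pow (W * y) m))) ⟩
    W * B m (W * y)
      ∎)
    where
    W : Carrier
    W = nat w
    offset : ℕ → Carrier
    offset i = ι (+ i / w)
    G : Seq
    G k = ∑ w (λ i → pow (offset i) k)
    W*offset≈i : ∀ i → W * offset i ≈ nat i
    W*offset≈i i = trans (*-cong refl (ι[m/[1+k]]≈ι[1/[1+k]]*m i v))
      (unit-*-cancelˡ (nat i) (trans (*-comm _ _) (ι[1/[1+k]]*[1+k]≈1 v)))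
    dilate-G : dilate W G ≋ geometric w
    dilate-G k = trans (sym (∑-*ˡ w (pow W k) (λ i → pow (offset i) k)))
      (∑-cong w (λ i → trans (sym (pow-distrib-* W (offset i) k)) (pow-cong k (W*offset≈i i))))

  bernoulliProductSum : Carrier → Carrier → Carrier → ℕ → Carrier
  bernoulliProductSum w y₁ y₂ n = Σ≤ n (λ k → nat (n C k) * B k y₁ * B (n ∸ k) (w * y₂) * pow w k)

  bernoulliProductSum≈⋆ : ∀ w y₁ y₂ n →
                          bernoulliProductSum w y₁ y₂ n ≈ (dilate w (Bseq y₁) ⋆ Bseq (w * y₂)) n
  bernoulliProductSum≈⋆ w y₁ y₂ n = trans (Σ<≈∑ (suc n) _)
    (trans (∑-cong (suc n) {g = λ k → nat (n C k) * dilate w (Bseq y₁) k * Bseq (w * y₂) (n ∸ k)}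
                   (λ k → trans (xy*z≈xz*y _ _ _) (*-cong (xy*z≈x*zy _ _ _) refl)))
           (binomial-sum≈⋆ n (dilate w (Bseq y₁)) (Bseq (w * y₂))))

  dilateB⋆B : ∀ w y₁ y₂ →
              dilate w (Bseq y₁) ⋆ Bseq (w * y₂) ≋ (dilate w β ⋆ β) ⋆ pow (w * y₁ + w * y₂)
  dilateB⋆B w y₁ y₂ n = begin
    (dilate w (Bseq y₁) ⋆ Bseq (w * y₂)) n
      ≈⟨ ⋆-cong (λ k → trans (*-cong refl (B≋β⋆pow y₁ k)) (dilate-β⋆pow w y₁ k))
                (B≋β⋆pow (w * y₂)) n ⟩
    ((dilate w β ⋆ pow (w * y₁)) ⋆ (β ⋆ pow (w * y₂))) n
      ≈⟨ ⋆-interchange _ _ _ _ n ⟩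
    ((dilate w β ⋆ β) ⋆ (pow (w * y₁) ⋆ pow (w * y₂))) n
      ≈⟨ ⋆-congʳ _ (pow⋆pow _ _) n ⟩
    ((dilate w β ⋆ β) ⋆ pow (w * y₁ + w * y₂)) n
      ∎

  bernoulliProductSum-comm : ∀ w y₁ y₂ n → bernoulliProductSum w y₁ y₂ n ≈ bernoulliProductSum w y₂ y₁ n
  bernoulliProductSum-comm w y₁ y₂ n = begin
    bernoulliProductSum w y₁ y₂ n                     ≈⟨ bernoulliProductSum≈⋆ w y₁ y₂ n ⟩
    (dilate w (Bseq y₁) ⋆ Bseq (w * y₂)) n            ≈⟨ dilateB⋆B w y₁ y₂ n ⟩
    ((dilate w β ⋆ β) ⋆ pow (w * y₁ + w * y₂)) n      ≈⟨ ⋆-congʳ _ (λ k → pow-cong k (+-comm _ _)) n ⟩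
    ((dilate w β ⋆ β) ⋆ pow (w * y₂ + w * y₁)) n      ≈⟨ dilateB⋆B w y₂ y₁ n ⟨
    (dilate w (Bseq y₂) ⋆ Bseq (w * y₁)) n            ≈⟨ bernoulliProductSum≈⋆ w y₂ y₁ n ⟨
    bernoulliProductSum w y₂ y₁ n                     ∎

  bernoulliProductSum-multiplication : ∀ w .{{_ : NonZero w}} y₁ y₂ n →
    bernoulliProductSum (nat w) y₁ y₂ n ≈
      ι (+ (w ^ n) / w) * Σ≤ n (λ k → nat (n C k) * B k y₁ * Σ< w (λ i → B (n ∸ k) (y₂ + ι (+ i / w))))
  bernoulliProductSum-multiplication w@(suc v) y₁ y₂ n = begin
    bernoulliProductSum W y₁ y₂ n                 ≈⟨ bernoulliProductSum≈⋆ W y₁ y₂ n ⟩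
    Ψ                                             ≈⟨ unit-*-cancelˡ Ψ (ι[1/[1+k]]*[1+k]≈1 v) ⟨
    ι (+ 1 / w) * (W * Ψ)                         ≈⟨ *-cong refl W*Ψ ⟩
    ι (+ 1 / w) * (pow W n * (Bseq y₁ ⋆ H) n)     ≈⟨ *-assoc _ _ _ ⟨
    (ι (+ 1 / w) * pow W n) * (Bseq y₁ ⋆ H) n     ≈⟨ *-cong (sym coefficient) (sym B⋆H) ⟩
    ι (+ (w ^ n) / w) * Σ≤ n (λ k → nat (n C k) * B k y₁ * H (n ∸ k)) ∎
    where
    W : Carrier
    W = nat w
    H : Seq
    H m = Σ< w (λ i → B m (y₂ + ι (+ i / w)))
    Ψ : Carrier
    Ψ = (dilate W (Bseq y₁) ⋆ Bseq (W * y₂)) n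
    W*Ψ : W * Ψ ≈ pow W n * (Bseq y₁ ⋆ H) n
    W*Ψ = begin
      W * Ψ                                          ≈⟨ ⋆-·ʳ W _ _ n ⟨
      (dilate W (Bseq y₁) ⋆ (W · Bseq (W * y₂))) n   ≈⟨ ⋆-congʳ _ (multiplication-theorem w y₂) n ⟩
      (dilate W (Bseq y₁) ⋆ dilate W H) n            ≈⟨ dilate-⋆ W _ _ n ⟩
      pow W n * (Bseq y₁ ⋆ H) n                      ∎
    B⋆H : Σ≤ n (λ k → nat (n C k) * B k y₁ * H (n ∸ k)) ≈ (Bseq y₁ ⋆ H) n
    B⋆H = trans (Σ<≈∑ (suc n) _) (binomial-sum≈⋆ n (Bseq y₁) H)
    coefficient : ι (+ (w ^ n) / w) ≈ ι (+ 1 / w) * pow W n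
    coefficient = trans (ι[m/[1+k]]≈ι[1/[1+k]]*m (w ^ n) v) (*-cong refl (nat-^ w n))

-- The identity holds in every commutative ℚ-algebra.
corollary7 : {c ℓ : Level} (A : QAlgebra c ℓ) →
    let open QAlg A in
    (p : ℕ) → Prime p →
    (w₁ : ℕ) → .{{_ : NonZero w₁}} →
    (y₁ y₂ : Carrier) → (n : ℕ) →
    (Σ≤ n (λ k → nat (n C k) * B k y₁ * B (n ∸ k) (nat w₁ * y₂) * pow (nat w₁) k)
      ≈ Σ≤ n (λ k → nat (n C k) * B k y₂ * B (n ∸ k) (nat w₁ * y₁) * pow (nat w₁) k))
    ×
    (Σ≤ n (λ k → nat (n C k) * B k y₂ * B (n ∸ k) (nat w₁ * y₁) * pow (nat w₁) k)
      ≈ ι ((+ (w₁ ^ n)) / w₁) *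
          Σ≤ n (λ k → nat (n C k) * B k y₁ *
            Σ< w₁ (λ i → B (n ∸ k) (y₂ + ι ((+ i) / w₁)))))
corollary7 A _ _ w y₁ y₂ n =
  bernoulliProductSum-comm A (nat w) y₁ y₂ n ,
  trans (bernoulliProductSum-comm A (nat w) y₂ y₁ n) (bernoulliProductSum-multiplication A w y₁ y₂ n)
  where open QAlg A
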